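{- For every integer $d\ge2$ there exists a $d$-dimensional alcoved polytope $P\subset\mathbb{R}^d$ with interior lattice points that has a facet whose lattice distance to the set of interior lattice points of $P$ equals $d-1$.
   Context: An alcove hyperplane in $\mathbb{R}^d$ is a hyperplane $\{y\in\mathbb{R}^d: y_i-y_j=k\}$ with $i\ne j\in\{0,\dots,d\}$, $k\in\mathbb{Z}$, and $y_0=0$. A $d$-polytope in $\mathbb{R}^d$ is alcoved if all its facet-defining hyperplanes are alcove hyperplanes. The lattice distance between a hyperplane $\{x: m^Tx=b\}$ ($m\in\mathbb{Z}^d$ primitive, $b\in\mathbb{Z}$) and a lattice point $p$ is $|m^Tp-b|$; the lattice distance of a facet to a lattice point is that of its affine hull, and to a set of lattice points is the minimum over the points of the set.
   Formalization: The ambient space ℝ^d is replaced by ℚ^d, so the polytope P, the affinely independent points on its facet and the balls around its interior lattice points have rational coordinates. -}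

module Defs where

open import Data.Nat as ℕ using (ℕ; zero; suc)
open import Data.Fin using (Fin; zero; suc)
open import Data.Integer as ℤ using (ℤ)
open import Data.Rational using (ℚ; 0ℚ; _+_; _-_; _*_; _≤_; _<_; ∣_∣; _/_)
open import Data.Product using (Σ; ∃; _×_; _,_)
open import Data.Sum using (_⊎_)
open import Relation.Binary.PropositionalEquality using (_≡_; _≢_)

-- Points of ℝ^d are represented by rational points.
Point : ℕ → Set
Point d = Fin d → ℚ

LatticePoint : ℕ → Set
LatticePoint d = Fin d → ℤ

ext : ∀ {d} → Point d → Fin (suc d) → ℚ
ext y zero    = 0ℚ
ext y (suc i) = y i

extℤ : ∀ {d} → LatticePoint d → Fin (suc d) → ℤ
extℤ p zero    = ℤ.+ 0
extℤ p (suc i) = p i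

toℚ : ∀ {d} → LatticePoint d → Point d
toℚ p i = p i / 1

Region : ℕ → Set₁
Region d = Point d → Set

AlcoveSystem : ℕ → Set
AlcoveSystem d = Fin (suc d) → Fin (suc d) → ℤ

alcovedPolytope : ∀ {d} → AlcoveSystem d → Region d
alcovedPolytope c y = ∀ i j → i ≢ j → ext y i - ext y j ≤ c i j / 1

record AlcoveHyperplane (d : ℕ) : Set where
  constructor alcoveHyperplane
  field
    i   : Fin (suc d)
    j   : Fin (suc d)
    i≢j : i ≢ j
    k   : ℤ
open AlcoveHyperplane public

OnH : ∀ {d} → AlcoveHyperplane d → Point d → Set
OnH H y = ext y (i H) - ext y (j H) ≡ k H / 1

BelowH : ∀ {d} → AlcoveHyperplane d → Point d → Set
BelowH H y = ext y (i H) - ext y (j H) ≤ k H / 1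

AboveH : ∀ {d} → AlcoveHyperplane d → Point d → Set
AboveH H y = k H / 1 ≤ ext y (i H) - ext y (j H)

sumFin : ∀ {n} → (Fin n → ℚ) → ℚ
sumFin {zero}  f = 0ℚ
sumFin {suc n} f = f zero + sumFin (λ s → f (suc s))

AffinelyIndependent : ∀ {d n} → (Fin n → Point d) → Set
AffinelyIndependent {d} {n} q =
  (λ′ : Fin n → ℚ) → sumFin λ′ ≡ 0ℚ →
  (∀ (t : Fin d) → sumFin (λ s → λ′ s * q s t) ≡ 0ℚ) →
  ∀ s → λ′ s ≡ 0ℚ

FullDimensional : ∀ {d} → Region d → Set
FullDimensional {d} P =
  Σ (Fin (suc d) → Point d) λ q → (∀ s → P (q s)) × AffinelyIndependent q

FacetDefining : ∀ {d} → Region d → AlcoveHyperplane d → Set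
FacetDefining {d} P H =
  ((∀ y → P y → BelowH H y) ⊎ (∀ y → P y → AboveH H y)) ×
  Σ (Fin d → Point d) λ q → (∀ s → P (q s)) × (∀ s → OnH H (q s)) × AffinelyIndependent q

Interior : ∀ {d} → Region d → Point d → Set
Interior {d} P y =
  Σ ℚ λ ε → (0ℚ < ε) × (∀ z → (∀ t → ∣ z t - y t ∣ ≤ ε) → P z)

-- lattice distance of the hyperplane y_i - y_j = k (normal e_i - e_j, primitive) to p
latticeDistance : ∀ {d} → AlcoveHyperplane d → LatticePoint d → ℕ
latticeDistance H p = ℤ.∣ (extℤ p (i H) ℤ.- extℤ p (j H)) ℤ.- k H ∣

-- Take P = { y : y_a - y_b ≤ max(1, min(a - b, d - 1)) for all a ≠ b in {0, …, d} }.
-- It contains the origin in its interior, it is full-dimensional because it contains the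
-- staircase points e_1 + ⋯ + e_s (0 ≤ s ≤ d), and y_d - y_0 = d - 1 defines a facet because
-- it contains the d affinely independent points (0, 1, …, d - 1) + e_1 + ⋯ + e_s (0 ≤ s < d).
-- At an interior point the inequalities y_{u+1} - y_u ≤ 1 are strict, so an interior lattice
-- point has y_{u+1} ≤ y_u for every u; hence y_d ≤ y_0 = 0, and its lattice distance to that
-- facet is at least d - 1, with equality at the origin.
module Submission where

open import Defs
open import Data.Nat using (ℕ; _≤_; _∸_)
open import Data.Product using (Σ; _×_)
open import Relation.Binary.PropositionalEquality using (_≡_)

open import Data.Nat as ℕ using (zero; suc; z≤n; s≤s; _⊔_; _⊓_)
import Data.Nat.Properties as ℕ
import Data.Nat.Coprimality as Coprimality
open import Data.Integer as ℤ using (ℤ; +_; -[1+_]; +[1+_]; _⊖_)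
import Data.Integer.Properties as ℤ
open import Data.Rational as ℚ using (ℚ; 0ℚ; 1ℚ; ½; mkℚ; *≤*; *<*)
import Data.Rational.Properties as ℚ
open import Data.Rational.Solver using (module +-*-Solver)
open import Data.Fin using (Fin; zero; suc; toℕ; fromℕ; fromℕ<; inject₁; _≟_)
import Data.Fin.Properties as Fin
open import Data.Vec.Functional using (updateAt)
open import Data.Vec.Functional.Properties using (updateAt-updates; updateAt-minimal)
open import Data.Product using (_,_)
open import Data.Sum using (inj₁)
open import Relation.Nullary using (yes; no)
open import Relation.Binary.PropositionalEquality
  using (_≢_; refl; sym; trans; cong; cong₂; subst; subst₂; module ≡-Reasoning)
open import Function using (_∘_)

-- Unlike n / 1, which normalises through a gcd, this has numerator n and denominator 1
-- definitionally.
fromℤ : ℤ → ℚ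
fromℤ n = mkℚ n 0 (Coprimality.sym (Coprimality.1-coprimeTo ℤ.∣ n ∣))

/1≡fromℤ : ∀ n → n ℚ./ 1 ≡ fromℤ n
/1≡fromℤ n = ℚ.↥p/↧p≡p (fromℤ n)

fromℤ-mono-≤ : ∀ {m n} → m ℤ.≤ n → fromℤ m ℚ.≤ fromℤ n
fromℤ-mono-≤ {m} {n} =
  *≤* ∘ subst₂ ℤ._≤_ (sym (ℤ.*-identityʳ m)) (sym (ℤ.*-identityʳ n))

fromℤ-cancel-< : ∀ {m n} → fromℤ m ℚ.< fromℤ n → m ℤ.< n
fromℤ-cancel-< {m} {n} (*<* m<n) = subst₂ ℤ._<_ (ℤ.*-identityʳ m) (ℤ.*-identityʳ n) m<n

fromℤ-+ : ∀ m n → fromℤ (m ℤ.+ n) ≡ fromℤ m ℚ.+ fromℤ n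
fromℤ-+ m n = sym (trans
  (cong (ℚ._/ 1) (cong₂ ℤ._+_ (ℤ.*-identityʳ m) (ℤ.*-identityʳ n))) (/1≡fromℤ (m ℤ.+ n)))

fromℤ-neg : ∀ n → fromℤ (ℤ.- n) ≡ ℚ.- fromℤ n
fromℤ-neg (+ zero)  = refl
fromℤ-neg +[1+ n ]  = refl
fromℤ-neg -[1+ n ]  = refl

fromℤ-sub : ∀ m n → fromℤ (m ℤ.- n) ≡ fromℤ m ℚ.- fromℤ n
fromℤ-sub m n = trans (fromℤ-+ m (ℤ.- n)) (cong (fromℤ m ℚ.+_) (fromℤ-neg n))

ext-toℚ : ∀ {d} (p : LatticePoint d) i → ext (toℚ p) i ≡ fromℤ (extℤ p i)
ext-toℚ p zero    = refl
ext-toℚ p (suc t) = /1≡fromℤ (p t)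

ext-toℚ-sub : ∀ {d} (p : LatticePoint d) i j →
              ext (toℚ p) i ℚ.- ext (toℚ p) j ≡ fromℤ (extℤ p i ℤ.- extℤ p j)
ext-toℚ-sub p i j =
  trans (cong₂ ℚ._-_ (ext-toℚ p i) (ext-toℚ p j)) (sym (fromℤ-sub (extℤ p i) (extℤ p j)))

sumFin-cong : ∀ {n} {f g : Fin n → ℚ} → (∀ s → f s ≡ g s) → sumFin f ≡ sumFin g
sumFin-cong {zero}  f≡g = refl
sumFin-cong {suc n} f≡g = cong₂ ℚ._+_ (f≡g zero) (sumFin-cong (f≡g ∘ suc))

sumFin-+ : ∀ {n} (f g : Fin n → ℚ) → sumFin (λ s → f s ℚ.+ g s) ≡ sumFin f ℚ.+ sumFin g
sumFin-+ {zero}  f g = refl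
sumFin-+ {suc n} f g = begin
  (f zero ℚ.+ g zero) ℚ.+ sumFin (λ s → f (suc s) ℚ.+ g (suc s))
    ≡⟨ cong ((f zero ℚ.+ g zero) ℚ.+_) (sumFin-+ (f ∘ suc) (g ∘ suc)) ⟩
  (f zero ℚ.+ g zero) ℚ.+ (sumFin (f ∘ suc) ℚ.+ sumFin (g ∘ suc))
    ≡⟨ interchange (f zero) (g zero) (sumFin (f ∘ suc)) (sumFin (g ∘ suc)) ⟩
  (f zero ℚ.+ sumFin (f ∘ suc)) ℚ.+ (g zero ℚ.+ sumFin (g ∘ suc)) ∎
  where
  open ≡-Reasoning
  open +-*-Solver
  interchange : ∀ a b c d → (a ℚ.+ b) ℚ.+ (c ℚ.+ d) ≡ (a ℚ.+ c) ℚ.+ (b ℚ.+ d)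
  interchange = solve 4 (λ a b c d → (a :+ b) :+ (c :+ d) := (a :+ c) :+ (b :+ d)) refl

sumFin-*ʳ : ∀ {n} (f : Fin n → ℚ) x → sumFin (λ s → f s ℚ.* x) ≡ sumFin f ℚ.* x
sumFin-*ʳ {zero}  f x = sym (ℚ.*-zeroˡ x)
sumFin-*ʳ {suc n} f x = trans (cong (f zero ℚ.* x ℚ.+_) (sumFin-*ʳ (f ∘ suc) x))
                              (sym (ℚ.*-distribʳ-+ x (f zero) (sumFin (f ∘ suc))))

affinelyIndependent-cong : ∀ {d n} {q q′ : Fin n → Point d} →
  (∀ s t → q s t ≡ q′ s t) → AffinelyIndependent q → AffinelyIndependent q′
affinelyIndependent-cong q≡q′ indep λ′ Σλ′≡0 Σλ′q′≡0 =
  indep λ′ Σλ′≡0 (λ t → trans (sumFin-cong (λ s → cong (λ′ s ℚ.*_) (q≡q′ s t))) (Σλ′q′≡0 t))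

affinelyIndependent-translate : ∀ {d n} (v : Point d) {q : Fin n → Point d} →
  AffinelyIndependent q → AffinelyIndependent (λ s t → v t ℚ.+ q s t)
affinelyIndependent-translate v {q} indep λ′ Σλ′≡0 Σλ′[v+q]≡0 = indep λ′ Σλ′≡0 Σλ′q≡0
  where
  Σλ′q≡0 : ∀ t → sumFin (λ s → λ′ s ℚ.* q s t) ≡ 0ℚ
  Σλ′q≡0 t = begin
    Σq                                    ≡⟨ ℚ.+-identityˡ Σq ⟨
    0ℚ ℚ.+ Σq                             ≡⟨ cong (ℚ._+ Σq) (ℚ.*-zeroˡ (v t)) ⟨
    0ℚ ℚ.* v t ℚ.+ Σq                     ≡⟨ cong (λ x → x ℚ.* v t ℚ.+ Σq) Σλ′≡0 ⟨
    sumFin λ′ ℚ.* v t ℚ.+ Σq              ≡⟨ cong (ℚ._+ Σq) (sumFin-*ʳ λ′ (v t)) ⟨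
    Σv ℚ.+ Σq                             ≡⟨ sumFin-+ (λ s → λ′ s ℚ.* v t) (λ s → λ′ s ℚ.* q s t) ⟨
    sumFin (λ s → λ′ s ℚ.* v t ℚ.+ λ′ s ℚ.* q s t)
      ≡⟨ sumFin-cong (λ s → ℚ.*-distribˡ-+ (λ′ s) (v t) (q s t)) ⟨
    sumFin (λ s → λ′ s ℚ.* (v t ℚ.+ q s t)) ≡⟨ Σλ′[v+q]≡0 t ⟩
    0ℚ                                    ∎
    where
    open ≡-Reasoning
    Σv Σq : ℚ
    Σv = sumFin (λ s → λ′ s ℚ.* v t)
    Σq = sumFin (λ s → λ′ s ℚ.* q s t)

[_<_] : ℕ → ℕ → ℕ
[ k     < zero  ] = 0
[ zero  < suc s ] = 1
[ suc k < suc s ] = [ k < s ]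

[<]≤1 : ∀ k s → [ k < s ] ≤ 1
[<]≤1 k       zero    = z≤n
[<]≤1 zero    (suc s) = ℕ.≤-refl
[<]≤1 (suc k) (suc s) = [<]≤1 k s

[<]-antitone : ∀ k s → [ suc k < s ] ≤ [ k < s ]
[<]-antitone k       zero    = z≤n
[<]-antitone zero    (suc s) = [<]≤1 0 s
[<]-antitone (suc k) (suc s) = [<]-antitone k s

[<]≡0 : ∀ {k s} → s ≤ k → [ k < s ] ≡ 0
[<]≡0 {k}     {zero}  _         = refl
[<]≡0 {suc k} {suc s} (s≤s s≤k) = [<]≡0 s≤k

+[<]≤⊔ : ∀ k s → k ℕ.+ [ k < s ] ≤ k ⊔ s
+[<]≤⊔ k       zero    = ℕ.≤-reflexive (trans (ℕ.+-identityʳ k) (sym (ℕ.⊔-identityʳ k)))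
+[<]≤⊔ zero    (suc s) = s≤s z≤n
+[<]≤⊔ (suc k) (suc s) = s≤s (+[<]≤⊔ k s)

tailSum : ∀ {n} → (Fin n → ℚ) → ℕ → ℚ
tailSum λ′ k = sumFin (λ s → λ′ s ℚ.* fromℤ (+ [ k < toℕ s ]))

tailSum-zero : ∀ {n} (λ′ : Fin (suc n) → ℚ) → tailSum λ′ 0 ≡ sumFin (λ′ ∘ suc)
tailSum-zero λ′ = begin
  λ′ zero ℚ.* 0ℚ ℚ.+ Σrest  ≡⟨ cong (ℚ._+ Σrest) (ℚ.*-zeroʳ (λ′ zero)) ⟩
  0ℚ ℚ.+ Σrest              ≡⟨ ℚ.+-identityˡ Σrest ⟩
  Σrest                     ≡⟨ sumFin-cong (ℚ.*-identityʳ ∘ λ′ ∘ suc) ⟩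
  sumFin (λ′ ∘ suc)         ∎
  where
  open ≡-Reasoning
  Σrest : ℚ
  Σrest = sumFin (λ s → λ′ (suc s) ℚ.* 1ℚ)

tailSum-suc : ∀ {n} (λ′ : Fin (suc n) → ℚ) k → tailSum λ′ (suc k) ≡ tailSum (λ′ ∘ suc) k
tailSum-suc λ′ k = trans (cong (ℚ._+ tailSum (λ′ ∘ suc) k) (ℚ.*-zeroʳ (λ′ zero)))
                         (ℚ.+-identityˡ (tailSum (λ′ ∘ suc) k))

-- The coefficients are recovered as differences of consecutive tail sums.
tailSums≡0⇒≡0 : ∀ {n} (λ′ : Fin n → ℚ) → sumFin λ′ ≡ 0ℚ →
  (∀ k → suc k ℕ.< n → tailSum λ′ k ≡ 0ℚ) → ∀ s → λ′ s ≡ 0ℚ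
tailSums≡0⇒≡0 {suc zero} λ′ Σλ′≡0 _ zero = trans (sym (ℚ.+-identityʳ (λ′ zero))) Σλ′≡0
tailSums≡0⇒≡0 {suc (suc n)} λ′ Σλ′≡0 tails≡0 = λ where
    zero    → λ′zero≡0
    (suc s) → tailSums≡0⇒≡0 (λ′ ∘ suc) Σrest≡0 tails-rest≡0 s
  where
  Σrest≡0 : sumFin (λ′ ∘ suc) ≡ 0ℚ
  Σrest≡0 = trans (sym (tailSum-zero λ′)) (tails≡0 0 (s≤s (s≤s z≤n)))
  tails-rest≡0 : ∀ k → suc k ℕ.< suc n → tailSum (λ′ ∘ suc) k ≡ 0ℚ
  tails-rest≡0 k 1+k<1+n = trans (sym (tailSum-suc λ′ k)) (tails≡0 (suc k) (s≤s 1+k<1+n))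
  λ′zero≡0 : λ′ zero ≡ 0ℚ
  λ′zero≡0 = begin
    λ′ zero                         ≡⟨ ℚ.+-identityʳ (λ′ zero) ⟨
    λ′ zero ℚ.+ 0ℚ                  ≡⟨ cong (λ′ zero ℚ.+_) Σrest≡0 ⟨
    λ′ zero ℚ.+ sumFin (λ′ ∘ suc)   ≡⟨ Σλ′≡0 ⟩
    0ℚ                              ∎
    where open ≡-Reasoning

staircase : ∀ {d n} → Fin n → Point d
staircase s t = fromℤ (+ [ toℕ t < toℕ s ])

staircase-affinelyIndependent : ∀ {d n} → n ≤ suc d → AffinelyIndependent (staircase {d} {n})
staircase-affinelyIndependent {d} n≤1+d λ′ Σλ′≡0 coords≡0 = tailSums≡0⇒≡0 λ′ Σλ′≡0 tail≡0
  where
  tail≡0 : ∀ k → suc k ℕ.< _ → tailSum λ′ k ≡ 0ℚ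
  tail≡0 k 1+k<n = subst (λ k′ → tailSum λ′ k′ ≡ 0ℚ) (Fin.toℕ-fromℕ< k<d) (coords≡0 (fromℕ< k<d))
    where
    k<d : k ℕ.< d
    k<d = ℕ.≤-pred (ℕ.≤-trans 1+k<n n≤1+d)

alcovedPolytope-toℚ : ∀ {d} (c : AlcoveSystem d) (p : LatticePoint d) →
  (∀ i j → i ≢ j → extℤ p i ℤ.- extℤ p j ℤ.≤ c i j) → alcovedPolytope c (toℚ p)
alcovedPolytope-toℚ c p p∈P i j i≢j =
  subst₂ ℚ._≤_ (sym (ext-toℚ-sub p i j)) (sym (/1≡fromℤ (c i j))) (fromℤ-mono-≤ (p∈P i j i≢j))

p≤∣p∣ : ∀ p → p ℚ.≤ ℚ.∣ p ∣
p≤∣p∣ (mkℚ (+ _) _ _)      = ℚ.≤-refl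
p≤∣p∣ p@(mkℚ -[1+ _ ] _ _) = ℚ.≤-trans (ℚ.nonPositive⁻¹ p) (ℚ.0≤∣p∣ p)

0<½ : 0ℚ ℚ.< ½
0<½ = *<* (ℤ.+<+ (s≤s z≤n))

origin : ∀ {d} → LatticePoint d
origin _ = + 0

origin-interior : ∀ {d} (c : AlcoveSystem d) → (∀ i j → i ≢ j → + 1 ℤ.≤ c i j) →
  Interior (alcovedPolytope c) (toℚ origin)
origin-interior c c≥1 = ½ , 0<½ , ball⊆P
  where
  ball⊆P : ∀ z → (∀ t → ℚ.∣ z t ℚ.- toℚ origin t ∣ ℚ.≤ ½) → alcovedPolytope c z
  ball⊆P z near i j i≢j = begin
    ext z i ℚ.- ext z j              ≤⟨ p≤∣p∣ (ext z i ℚ.- ext z j) ⟩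
    ℚ.∣ ext z i ℚ.- ext z j ∣        ≤⟨ ℚ.∣p-q∣≤∣p∣+∣q∣ (ext z i) (ext z j) ⟩
    ℚ.∣ ext z i ∣ ℚ.+ ℚ.∣ ext z j ∣  ≤⟨ ℚ.+-mono-≤ (small i) (small j) ⟩
    fromℤ (+ 1)                      ≤⟨ fromℤ-mono-≤ (c≥1 i j i≢j) ⟩
    fromℤ (c i j)                    ≡⟨ /1≡fromℤ (c i j) ⟨
    c i j ℚ./ 1                      ∎
    where
    open ℚ.≤-Reasoning
    small : ∀ i → ℚ.∣ ext z i ∣ ℚ.≤ ½
    small zero    = ℚ.<⇒≤ 0<½
    small (suc t) = subst (λ x → ℚ.∣ x ∣ ℚ.≤ ½) (ℚ.+-identityʳ (z t)) (near t)

-- Pushing the coordinate u of an interior point by its radius ε stays in the polytope,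
-- so the inequality y_{u+1} - y_j ≤ c is strict at a lattice point.
interior-strict : ∀ {d} (c : AlcoveSystem d) (p : LatticePoint d) →
  Interior (alcovedPolytope c) (toℚ p) →
  ∀ u j → suc u ≢ j → extℤ p (suc u) ℤ.- extℤ p j ℤ.< c (suc u) j
interior-strict c p (ε , ε>0 , ball⊆P) u j 1+u≢j = fromℤ-cancel-< (begin-strict
  fromℤ (p u ℤ.- extℤ p j)      ≡⟨ fromℤ-sub (p u) (extℤ p j) ⟩
  x ℚ.- y                       ≡⟨ ℚ.+-identityʳ (x ℚ.- y) ⟨
  (x ℚ.- y) ℚ.+ 0ℚ              <⟨ ℚ.+-monoʳ-< (x ℚ.- y) ε>0 ⟩
  (x ℚ.- y) ℚ.+ ε               ≡⟨ shift x y ε ⟩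
  (x ℚ.+ ε) ℚ.- y               ≡⟨ cong₂ ℚ._-_ z-moved (z-fixed j 1+u≢j) ⟨
  ext z (suc u) ℚ.- ext z j     ≤⟨ ball⊆P z near (suc u) j 1+u≢j ⟩
  c (suc u) j ℚ./ 1             ≡⟨ /1≡fromℤ (c (suc u) j) ⟩
  fromℤ (c (suc u) j)           ∎)
  where
  open ℚ.≤-Reasoning
  open +-*-Solver
  x y : ℚ
  x = fromℤ (p u)
  y = fromℤ (extℤ p j)
  shift : ∀ a b e → (a ℚ.- b) ℚ.+ e ≡ (a ℚ.+ e) ℚ.- b
  shift = solve 3 (λ a b e → (a :- b) :+ e := (a :+ e) :- b) refl
  cancel : ∀ a e → (a ℚ.+ e) ℚ.- a ≡ e
  cancel = solve 2 (λ a e → (a :+ e) :- a := e) refl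
  z : Point _
  z = updateAt (toℚ p) u (ℚ._+ ε)
  near : ∀ t → ℚ.∣ z t ℚ.- toℚ p t ∣ ℚ.≤ ε
  near t with t ≟ u
  ... | yes refl = ℚ.≤-reflexive (trans (cong ℚ.∣_∣ moved) (ℚ.0≤p⇒∣p∣≡p (ℚ.<⇒≤ ε>0)))
    where
    moved : z u ℚ.- toℚ p u ≡ ε
    moved = trans (cong (ℚ._- toℚ p u) (updateAt-updates u (toℚ p))) (cancel (toℚ p u) ε)
  ... | no t≢u = subst (λ a → ℚ.∣ a ∣ ℚ.≤ ε) (sym fixed) (ℚ.<⇒≤ ε>0)
    where
    fixed : z t ℚ.- toℚ p t ≡ 0ℚ
    fixed = trans (cong (ℚ._- toℚ p t) (updateAt-minimal t u (toℚ p) t≢u)) (ℚ.+-inverseʳ (toℚ p t))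
  z-moved : ext z (suc u) ≡ x ℚ.+ ε
  z-moved = trans (updateAt-updates u (toℚ p)) (cong (ℚ._+ ε) (/1≡fromℤ (p u)))
  z-fixed : ∀ j → suc u ≢ j → ext z j ≡ fromℤ (extℤ p j)
  z-fixed zero    _      = refl
  z-fixed (suc w) 1+u≢1+w =
    trans (updateAt-minimal w u (toℚ p) (λ w≡u → 1+u≢1+w (cong suc (sym w≡u)))) (/1≡fromℤ (p w))

antitone⇒≤head : ∀ {n} (f : Fin (suc n) → ℤ) → (∀ u → f (suc u) ℤ.≤ f (inject₁ u)) →
                 ∀ i → f i ℤ.≤ f zero
antitone⇒≤head         f _    zero    = ℤ.≤-refl
antitone⇒≤head {suc n} f desc (suc i) =
  ℤ.≤-trans (antitone⇒≤head (f ∘ suc) (desc ∘ suc) i) (desc zero)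

n≤∣x-n∣ : ∀ {x} n → x ℤ.≤ + 0 → n ≤ ℤ.∣ x ℤ.- + n ∣
n≤∣x-n∣ {+ zero}   zero    _ = z≤n
n≤∣x-n∣ {+ zero}   (suc n) _ = ℕ.≤-refl
n≤∣x-n∣ { -[1+ r ]} zero    _ = z≤n
n≤∣x-n∣ { -[1+ r ]} (suc n) _ = s≤s (ℕ.≤-trans (ℕ.m≤n+m n r) (ℕ.n≤1+n _))
n≤∣x-n∣ {+[1+ _ ]} _       (ℤ.+≤+ ())

profile : ∀ {d} → (ℕ → ℕ) → LatticePoint d
profile G t = + G (suc (toℕ t))

extℤ-profile : ∀ {d} (G : ℕ → ℕ) → G 0 ≡ 0 → ∀ (a : Fin (suc d)) → extℤ (profile G) a ≡ + G (toℕ a)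
extℤ-profile G G0≡0 zero    = cong +_ (sym G0≡0)
extℤ-profile G _    (suc t) = refl

m≤n+o⇒m-n≤o : ∀ {g h c} → g ≤ h ℕ.+ c → + g ℤ.- + h ℤ.≤ + c
m≤n+o⇒m-n≤o {g} {h} {c} g≤h+c = begin
  + g ℤ.- + h          ≡⟨ ℤ.m-n≡m⊖n g h ⟩
  g ⊖ h                ≤⟨ ℤ.⊖-monoˡ-≤ h g≤h+c ⟩
  (h ℕ.+ c) ⊖ h        ≡⟨ cong ((h ℕ.+ c) ⊖_) (ℕ.+-identityʳ h) ⟨
  (h ℕ.+ c) ⊖ (h ℕ.+ 0) ≡⟨ ℤ.+-cancelˡ-⊖ h c 0 ⟩
  + c                  ∎
  where open ℤ.≤-Reasoning

profile-alcoved : ∀ {d} (c : ℕ → ℕ → ℕ) (G : ℕ → ℕ) → G 0 ≡ 0 →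
  (∀ a b → a ≤ d → G a ≤ G b ℕ.+ c a b) →
  alcovedPolytope (λ (i j : Fin (suc d)) → + c (toℕ i) (toℕ j)) (toℚ (profile G))
profile-alcoved c G G0≡0 G≤ = alcovedPolytope-toℚ _ (profile G) λ i j _ →
  subst₂ (λ x y → x ℤ.- y ℤ.≤ + c (toℕ i) (toℕ j))
    (sym (extℤ-profile G G0≡0 i)) (sym (extℤ-profile G G0≡0 j))
    (m≤n+o⇒m-n≤o (G≤ (toℕ i) (toℕ j) (Fin.toℕ≤pred[n] i)))

increments≤1⇒≤+∸ : ∀ (G : ℕ → ℕ) → (∀ n → G n ≤ G (suc n)) → (∀ n → G (suc n) ≤ suc (G n)) →
  ∀ a b → G a ≤ G b ℕ.+ (a ∸ b)
increments≤1⇒≤+∸ G mono step zero    zero    = ℕ.m≤m+n (G 0) 0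
increments≤1⇒≤+∸ G mono step zero    (suc b) = ℕ.≤-trans (mono 0)
  (subst (λ k → G 1 ≤ G (suc b) ℕ.+ k) (ℕ.0∸n≡0 b)
    (increments≤1⇒≤+∸ (G ∘ suc) (mono ∘ suc) (step ∘ suc) zero b))
increments≤1⇒≤+∸ G mono step (suc a) zero    = ℕ.≤-trans (step a)
  (subst (suc (G a) ≤_) (sym (ℕ.+-suc (G 0) a)) (s≤s (increments≤1⇒≤+∸ G mono step a zero)))
increments≤1⇒≤+∸ G mono step (suc a) (suc b) =
  increments≤1⇒≤+∸ (G ∘ suc) (mono ∘ suc) (step ∘ suc) a b

bound : ℕ → ℕ → ℕ → ℕ
bound d a b = 1 ⊔ ((a ∸ b) ⊓ (d ∸ 1))

system : ∀ d → AlcoveSystem d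
system d i j = + bound d (toℕ i) (toℕ j)

1≤bound : ∀ d a b → 1 ≤ bound d a b
1≤bound d a b = ℕ.m≤m⊔n 1 ((a ∸ b) ⊓ (d ∸ 1))

bound-adjacent : ∀ d n → bound d (suc n) n ≡ 1
bound-adjacent d n = trans (cong (λ k → 1 ⊔ (k ⊓ (d ∸ 1))) (ℕ.m+n∸n≡m 1 n)) (ℕ.⊔-absorbs-⊓ 1 (d ∸ 1))

bound-corner : ∀ m → bound (suc (suc m)) (suc (suc m)) 0 ≡ suc m
bound-corner m = cong (1 ⊔_) (ℕ.m≥n⇒m⊓n≡n (ℕ.n≤1+n (suc m)))

≤+bound : ∀ d {a b g h} → g ≤ h ℕ.+ (a ∸ b) → g ≤ h ℕ.+ (d ∸ 1) → g ≤ h ℕ.+ bound d a b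
≤+bound d {a} {b} {g} {h} g≤h+[a-b] g≤h+[d-1] = begin
  g                                   ≤⟨ ℕ.⊓-glb g≤h+[a-b] g≤h+[d-1] ⟩
  (h ℕ.+ (a ∸ b)) ⊓ (h ℕ.+ (d ∸ 1))   ≡⟨ ℕ.+-distribˡ-⊓ h (a ∸ b) (d ∸ 1) ⟨
  h ℕ.+ ((a ∸ b) ⊓ (d ∸ 1))           ≤⟨ ℕ.+-monoʳ-≤ h (ℕ.m≤n⊔m 1 _) ⟩
  h ℕ.+ bound d a b                   ∎
  where open ℕ.≤-Reasoning

staircaseHeight : ℕ → ℕ → ℕ
staircaseHeight s zero    = 0
staircaseHeight s (suc t) = [ t < s ]

staircaseHeight≤1 : ∀ s a → staircaseHeight s a ≤ 1
staircaseHeight≤1 s zero    = z≤n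
staircaseHeight≤1 s (suc t) = [<]≤1 t s

staircase-alcoved : ∀ d s → alcovedPolytope (system d) (toℚ (profile (staircaseHeight s)))
staircase-alcoved d s = profile-alcoved (bound d) (staircaseHeight s) refl λ a b _ →
  ℕ.≤-trans (staircaseHeight≤1 s a) (ℕ.≤-trans (1≤bound d a b) (ℕ.m≤n+m _ (staircaseHeight s b)))

facetHeight : ℕ → ℕ → ℕ
facetHeight s zero    = 0
facetHeight s (suc t) = t ℕ.+ [ t < s ]

facetHeight-mono : ∀ s n → facetHeight s n ≤ facetHeight s (suc n)
facetHeight-mono s zero    = z≤n
facetHeight-mono s (suc t) = ℕ.≤-trans (ℕ.+-monoʳ-≤ t ([<]≤1 t s))
  (subst (_≤ suc t ℕ.+ [ suc t < s ]) (ℕ.+-comm 1 t) (ℕ.m≤m+n (suc t) _))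

facetHeight-step : ∀ s n → facetHeight s (suc n) ≤ suc (facetHeight s n)
facetHeight-step s zero    = [<]≤1 0 s
facetHeight-step s (suc t) = s≤s (ℕ.+-monoʳ-≤ t ([<]-antitone t s))

facetHeight-≤ : ∀ {n s a} → s ≤ n → a ≤ suc n → facetHeight s a ≤ n
facetHeight-≤ {a = zero}  _   _           = z≤n
facetHeight-≤ {a = suc t} s≤n (s≤s t≤n) = ℕ.≤-trans (+[<]≤⊔ t _) (ℕ.⊔-lub t≤n s≤n)

facet-alcoved : ∀ {n s} → s ≤ n → alcovedPolytope (system (suc n)) (toℚ (profile (facetHeight s)))
facet-alcoved {n} {s} s≤n = profile-alcoved (bound (suc n)) (facetHeight s) refl λ a b a≤1+n →
  ≤+bound (suc n) {a} {b}
    (increments≤1⇒≤+∸ (facetHeight s) (facetHeight-mono s) (facetHeight-step s) a b)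
    (ℕ.≤-trans (facetHeight-≤ s≤n a≤1+n) (ℕ.m≤n+m n (facetHeight s b)))

cornerFacet : ∀ n → AlcoveHyperplane (suc n)
cornerFacet n = alcoveHyperplane (fromℕ (suc n)) zero (λ ()) (+ n)

facetHeight-top : ∀ {n s} → s ≤ n → facetHeight s (suc n) ≡ n
facetHeight-top {n} s≤n = trans (cong (n ℕ.+_) ([<]≡0 s≤n)) (ℕ.+-identityʳ n)

facet-onCorner : ∀ {n s} → s ≤ n → OnH (cornerFacet n) (toℚ (profile (facetHeight s)))
facet-onCorner {n} {s} s≤n = begin
  ext (toℚ p) (fromℕ (suc n)) ℚ.- ext (toℚ p) zero   ≡⟨ ext-toℚ-sub p (fromℕ (suc n)) zero ⟩
  fromℤ (extℤ p (fromℕ (suc n)) ℤ.- + 0)             ≡⟨ cong fromℤ (ℤ.+-identityʳ _) ⟩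
  fromℤ (+ facetHeight s (suc (toℕ (fromℕ n))))
    ≡⟨ cong (fromℤ ∘ +_) (trans (cong (facetHeight s ∘ suc) (Fin.toℕ-fromℕ n)) (facetHeight-top s≤n)) ⟩
  fromℤ (+ n)                                        ≡⟨ /1≡fromℤ (+ n) ⟨
  + n ℚ./ 1                                          ∎
  where
  open ≡-Reasoning
  p : LatticePoint (suc n)
  p = profile (facetHeight s)

alcoved⇒belowCorner : ∀ m y → alcovedPolytope (system (suc (suc m))) y →
  BelowH (cornerFacet (suc m)) y
alcoved⇒belowCorner m y y∈P = subst (λ k → ext y last ℚ.- ext y zero ℚ.≤ + k ℚ./ 1)
  (trans (cong (λ a → bound (suc (suc m)) a 0) (Fin.toℕ-fromℕ (suc (suc m)))) (bound-corner m))
  (y∈P last zero (λ ()))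
  where
  last : Fin (suc (suc (suc m)))
  last = fromℕ (suc (suc m))

interior-descending : ∀ {d} (p : LatticePoint d) → Interior (alcovedPolytope (system d)) (toℚ p) →
  ∀ u → extℤ p (suc u) ℤ.≤ extℤ p (inject₁ u)
interior-descending {d} p p° u = ℤ.i-j≤0⇒i≤j (ℤ.i<j⇒i≤pred[j] strict)
  where
  adjacent≡1 : system d (suc u) (inject₁ u) ≡ + 1
  adjacent≡1 = cong +_ (trans (cong (bound d (suc (toℕ u))) (Fin.toℕ-inject₁ u))
                              (bound-adjacent d (toℕ u)))
  1+u≢u : suc u ≢ inject₁ u
  1+u≢u 1+u≡u = ℕ.1+n≢n (trans (cong toℕ 1+u≡u) (Fin.toℕ-inject₁ u))
  strict : extℤ p (suc u) ℤ.- extℤ p (inject₁ u) ℤ.< + 1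
  strict = subst (extℤ p (suc u) ℤ.- extℤ p (inject₁ u) ℤ.<_) adjacent≡1
     (interior-strict (system d) p p° u (inject₁ u) 1+u≢u)

interior-farFromCorner : ∀ {n} (p : LatticePoint (suc n)) →
  Interior (alcovedPolytope (system (suc n))) (toℚ p) → n ≤ latticeDistance (cornerFacet n) p
interior-farFromCorner {n} p p° = n≤∣x-n∣ n (subst (ℤ._≤ + 0) (sym (ℤ.+-identityʳ _))
  (antitone⇒≤head (extℤ p) (interior-descending p p°) (fromℕ (suc n))))

vertex : ∀ {d} → Fin (suc d) → Point d
vertex s = toℚ (profile (staircaseHeight (toℕ s)))

vertex-affinelyIndependent : ∀ {d} → AffinelyIndependent (vertex {d})
vertex-affinelyIndependent =
  affinelyIndependent-cong (λ s t → sym (/1≡fromℤ (+ [ toℕ t < toℕ s ])))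
    (staircase-affinelyIndependent ℕ.≤-refl)

facetVertex : ∀ {d} → Fin d → Point d
facetVertex s = toℚ (profile (facetHeight (toℕ s)))

facetVertex-affinelyIndependent : ∀ {d} → AffinelyIndependent (facetVertex {d})
facetVertex-affinelyIndependent {d} =
  affinelyIndependent-cong translate≡facetVertex
    (affinelyIndependent-translate (λ t → fromℤ (+ toℕ t)) {staircase}
      (staircase-affinelyIndependent (ℕ.n≤1+n d)))
  where
  translate≡facetVertex : ∀ s t → fromℤ (+ toℕ t) ℚ.+ staircase s t ≡ facetVertex s t
  translate≡facetVertex s t = sym (trans (/1≡fromℤ (+ (toℕ t ℕ.+ [ toℕ t < toℕ s ])))
                                         (fromℤ-+ (+ toℕ t) (+ [ toℕ t < toℕ s ])))

proposition2p8 : (d : ℕ) → 2 ≤ d →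
    Σ (AlcoveSystem d) λ c →
      FullDimensional (alcovedPolytope c) ×
      Σ (AlcoveHyperplane d) λ H →
        FacetDefining (alcovedPolytope c) H ×
        Σ (LatticePoint d) (λ p → Interior (alcovedPolytope c) (toℚ p) × latticeDistance H p ≡ d ∸ 1) ×
        ((p : LatticePoint d) → Interior (alcovedPolytope c) (toℚ p) → d ∸ 1 ≤ latticeDistance H p)
proposition2p8 d@(suc (suc m)) (s≤s (s≤s z≤n)) =
  system d ,
  (vertex , (λ s → staircase-alcoved d (toℕ s)) , vertex-affinelyIndependent) ,
  cornerFacet (suc m) ,
  (inj₁ (alcoved⇒belowCorner m) ,
   facetVertex ,
   (λ s → facet-alcoved (Fin.toℕ≤pred[n] s)) ,
   (λ s → facet-onCorner (Fin.toℕ≤pred[n] s)) ,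
   facetVertex-affinelyIndependent) ,
  (origin , origin-interior (system d) (λ i j _ → ℤ.+≤+ (1≤bound d (toℕ i) (toℕ j))) , refl) ,
  interior-farFromCorner
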